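{- Let $m\le n$ be positive integers, let $\rho:\{0,1\}^n\to\{0,1\}^n$ be the generalized rotation with parameter $m$, let $w\in\{0,1\}^n$ and let $p$ be the smallest positive integer with $\rho^p(w)=w$. Then for every $j\in\{0,1,\dots,n-1\}$, \[ \sum_{k=0}^{p-1}\rho^k(w)_j=\sum_{k=0}^{p-1}\rho^k(w)_{n-1-j}. \]
   Context: For a word $w=w_0w_1\cdots w_{n-1}\in\{0,1\}^n$, $w_i$ is its $i$-th letter and $w_{[i,j]}=w_i\cdots w_j$. The generalized rotation $\rho$ (with parameter $m$, $1\le m\le n$) is defined by: if there is $k<m$ such that $w_{[0,k]}=1^k0$ (i.e. $w$ begins with exactly $k$ ones followed by a $0$), then $\rho(w)=w_{k+1}\cdots w_{n-1}\,0\,1^k$; otherwise (i.e. $w$ begins with $m$ ones) $\rho(w)=w_m\cdots w_{n-1}1^m$, where $1^k$ denotes $k$ consecutive ones. $\rho^k(w)_i$ denotes the $i$-th letter of $\rho^k(w)$. -}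

module Defs where

open import Data.Nat using (ℕ; zero; suc; _+_)
open import Data.Bool using (Bool; true; false)
open import Data.List using (List; []; _∷_; _++_; replicate; drop)

-- Binary words are lists of Bool (true = letter 1, false = letter 0).

-- Generalized rotation with parameter m, via an accumulator:
-- rotAux r k w : we have already stripped k leading ones (k < m originally),
-- r = m - k ones may still be stripped, w is the remaining suffix.
rotAux : ℕ → ℕ → List Bool → List Bool
-- w began with exactly m ones: rho(w) = w_m ... w_{n-1} 1^m
rotAux zero    k w            = w ++ replicate k true
-- w begins with exactly k ones followed by 0 (k < m): rho(w) = w_{k+1}... 0 1^k
rotAux (suc r) k (false ∷ w) = w ++ (false ∷ replicate k true)
rotAux (suc r) k (true ∷ w)  = rotAux r (suc k) w
-- only reachable for words shorter than m (excluded by m ≤ n); identity-like fallback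
rotAux (suc r) k []           = replicate k true

ρ : ℕ → List Bool → List Bool
ρ m w = rotAux m 0 w

iter : {A : Set} → (A → A) → ℕ → A → A
iter f zero    x = x
iter f (suc k) x = f (iter f k x)

-- numerical value (0 or 1) of the i-th letter (0 if out of range; never used then)
letter : List Bool → ℕ → ℕ
letter []          i       = 0
letter (true  ∷ w) zero    = 1
letter (false ∷ w) zero    = 0
letter (b ∷ w)     (suc i) = letter w i

sumTo : ℕ → (ℕ → ℕ) → ℕ
sumTo zero    f = 0
sumTo (suc p) f = sumTo p f + f p

-- Let 0x be x with an extra 0 in front, serving as a fixed origin, and let Φ(x) be a sum over all
-- ordered pairs of zeros of 0x of a weight that depends only on the number of letters between
-- them (read cyclically) and on whether the pair wraps around the origin; the weights are
-- indicators of residue classes mod m. For x = 1ᵏ0u with k < m the step x ↦ ρ(x) merely rotates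
-- the cyclic word 0x, and for x = 1ᵐu it shifts all zeros of u by m; in both cases the zeros of
-- 0x and 0ρ(x) correspond one to one, and comparing the weights of corresponding pairs gives
--   Φ(ρ x) + x_{n−1−j} = Φ(x) + x_j.
-- Summed over a period of w, this telescopes to the claim.
module Submission where

open import Defs
open import Data.Nat using (ℕ; _≤_; _<_; _∸_; suc)
open import Data.Bool using (Bool)
open import Data.List using (List; length)
open import Relation.Binary.PropositionalEquality using (_≡_; _≢_)

open import Data.Nat using (zero; _+_; _%_; z≤n; s≤s; s≤s⁻¹; NonZero; ≢-nonZero⁻¹; _≟_; _<?_)
open import Data.Nat.Properties
open import Data.Nat.DivMod using ([m+n]%n≡m%n; m<n⇒m%n≡m)
open import Data.Nat.ListAction using (sum)
open import Data.Nat.ListAction.Properties using (sum-↭)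
open import Data.Nat.Tactic.RingSolver using (solve-∀)
open import Data.Bool using (true; false)
open import Data.List using ([]; _∷_; _++_; _∷ʳ_; map; replicate)
open import Data.List.Properties using (map-∘; map-cong; map-cong-local; map-id; length-++; length-replicate; ++-identityʳ)
open import Data.List.Relation.Unary.All as All using (All; []; _∷_)
open import Data.List.Relation.Binary.Permutation.Propositional using (_↭_; ↭-sym)
open import Data.List.Relation.Binary.Permutation.Propositional.Properties using (map⁺; ∷↭∷ʳ)
open import Function using (_∘_; id)
open import Relation.Nullary using (yes; no; contradiction)
open import Relation.Binary.PropositionalEquality using (refl; sym; trans; cong; cong₂; subst; module ≡-Reasoning)
open import Algebra.Properties.CommutativeSemigroup +-commutativeSemigroup
  using (interchange; x∙yz≈xz∙y; xy∙z≈xz∙y)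

open ≡-Reasoning

δ : ℕ → ℕ → ℕ
δ zero    zero    = 1
δ zero    (suc b) = 0
δ (suc a) zero    = 0
δ (suc a) (suc b) = δ a b

δ-refl : ∀ a → δ a a ≡ 1
δ-refl zero    = refl
δ-refl (suc a) = δ-refl a

δ-≢ : ∀ {a b} → a ≢ b → δ a b ≡ 0
δ-≢ {zero}  {zero}  a≢b = contradiction refl a≢b
δ-≢ {zero}  {suc b} _   = refl
δ-≢ {suc a} {zero}  _   = refl
δ-≢ {suc a} {suc b} a≢b = δ-≢ (a≢b ∘ cong suc)

δ-+ˡ : ∀ k a b → δ (k + a) (k + b) ≡ δ a b
δ-+ˡ zero    a b = refl
δ-+ˡ (suc k) a b = δ-+ˡ k a b

δ-∸-reflect : ∀ {n z j} → z ≤ n → j ≤ n → δ z (n ∸ j) ≡ δ (n ∸ z) j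
δ-∸-reflect {n} {z} {j} z≤ j≤ with z ≟ n ∸ j
... | yes refl = trans (δ-refl (n ∸ j)) (sym (trans (cong (λ i → δ i j) (m∸[m∸n]≡n j≤)) (δ-refl j)))
... | no z≢n∸j = trans (δ-≢ z≢n∸j) (sym (δ-≢ {n ∸ z} λ n∸z≡j → z≢n∸j (trans (sym (m∸[m∸n]≡n z≤)) (cong (n ∸_) n∸z≡j))))

∑ : List ℕ → (ℕ → ℕ) → ℕ
∑ xs f = sum (map f xs)

syntax ∑ xs (λ x → e) = ∑[ x ∈ xs ] e

∑-+ : ∀ (f g : ℕ → ℕ) xs → ∑[ x ∈ xs ] (f x + g x) ≡ ∑ xs f + ∑ xs g
∑-+ f g []       = refl
∑-+ f g (x ∷ xs) = trans (cong (f x + g x +_) (∑-+ f g xs)) (interchange (f x) (g x) (∑ xs f) (∑ xs g))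

∑-map : ∀ (f g : ℕ → ℕ) xs → ∑ (map g xs) f ≡ ∑ xs (f ∘ g)
∑-map f g xs = cong sum (sym (map-∘ xs))

∑-cong : ∀ {f g : ℕ → ℕ} xs → (∀ x → f x ≡ g x) → ∑ xs f ≡ ∑ xs g
∑-cong xs f≗g = cong sum (map-cong f≗g xs)

∑-cong-All : ∀ {P : ℕ → Set} {f g : ℕ → ℕ} {xs} → All P xs → (∀ {x} → P x → f x ≡ g x) → ∑ xs f ≡ ∑ xs g
∑-cong-All ps f≗g = cong sum (map-cong-local (All.map f≗g ps))

∑-↭ : ∀ (f : ℕ → ℕ) {xs ys} → xs ↭ ys → ∑ xs f ≡ ∑ ys f
∑-↭ f xs↭ys = sum-↭ (map⁺ f xs↭ys)

count : ℕ → List ℕ → ℕ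
count c zs = ∑[ z ∈ zs ] δ z c

count-absent : ∀ {c} zs → All (c <_) zs → count c zs ≡ 0
count-absent []       []           = refl
count-absent (z ∷ zs) (c<z ∷ c<zs) = cong₂ _+_ (δ-≢ (>⇒≢ c<z)) (count-absent zs c<zs)

∑-exchange : ∀ {P : ℕ → Set} {f g h k : ℕ → ℕ} {xs} → All P xs →
             (∀ {x} → P x → f x + g x ≡ h x + k x) → ∑ xs f + ∑ xs g ≡ ∑ xs h + ∑ xs k
∑-exchange {f = f} {g} {h} {k} {xs} ps pointwise =
  trans (sym (∑-+ f g xs)) (trans (∑-cong-All ps pointwise) (∑-+ h k xs))

swap-complements : ∀ {a b c d e f} → a + c ≡ b + d → e + c ≡ f + d → a + f ≡ b + e
swap-complements {a} {b} {c} {d} {e} {f} a+c≡b+d e+c≡f+d = +-cancelʳ-≡ (c + d) (a + f) (b + e) (begin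
    a + f + (c + d)  ≡⟨ interchange a f c d ⟩
    a + c + (f + d)  ≡⟨ cong₂ _+_ a+c≡b+d (sym e+c≡f+d) ⟩
    b + d + (e + c)  ≡⟨ interchange b d e c ⟩
    b + e + (d + c)  ≡⟨ cong (b + e +_) (+-comm d c) ⟩
    b + e + (c + d)  ∎)

hits : (M : ℕ) .{{_ : NonZero M}} → ℕ → ℕ → ℕ
hits M zero    w       = δ (w % M) 0
hits M (suc i) zero    = 0
hits M (suc i) (suc w) = hits M i w

module _ (M : ℕ) .{{_ : NonZero M}} where

  hits-below : ∀ i w → w < M → hits M i w ≡ δ w i
  hits-below zero    w       w<M = cong (λ r → δ r 0) (m<n⇒m%n≡m w<M)
  hits-below (suc i) zero    _   = refl
  hits-below (suc i) (suc w) w<M = hits-below i w (<-trans (n<1+n w) w<M)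

  hits-offset : ∀ i e → hits M i (i + e) ≡ hits M 0 e
  hits-offset zero    e = refl
  hits-offset (suc i) e = hits-offset i e

  hits₀-periodic : ∀ w → hits M 0 (M + w) ≡ hits M 0 w
  hits₀-periodic w = trans (cong (λ r → δ (r % M) 0) (+-comm M w)) (cong (λ r → δ r 0) ([m+n]%n≡m%n w M))

  M+w≢0 : ∀ w → M + w ≢ 0
  M+w≢0 w M+w≡0 = ≢-nonZero⁻¹ M (m+n≡0⇒m≡0 M M+w≡0)

  hits-split : ∀ i w → hits M i w ≡ hits M (i + M) w + δ w i
  hits-split zero w with w <? M
  ... | yes w<M = begin
      hits M 0 w           ≡⟨ hits-below 0 w w<M ⟩
      δ w 0                ≡⟨ cong (_+ δ w 0) (trans (hits-below M w w<M) (δ-≢ (<⇒≢ w<M))) ⟨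
      hits M M w + δ w 0   ∎
  ... | no w≮M = subst (λ v → hits M 0 v ≡ hits M M v + δ v 0) (m+[n∸m]≡n (≮⇒≥ w≮M)) (begin
      hits M 0 (M + e)                 ≡⟨ hits₀-periodic e ⟩
      hits M 0 e                       ≡⟨ hits-offset M e ⟨
      hits M M (M + e)                 ≡⟨ +-identityʳ _ ⟨
      hits M M (M + e) + 0             ≡⟨ cong (hits M M (M + e) +_) (δ-≢ (M+w≢0 e)) ⟨
      hits M M (M + e) + δ (M + e) 0   ∎)
    where e = w ∸ M
  hits-split (suc i) zero    = refl
  hits-split (suc i) (suc w) = hits-split i w

hits-periodic : ∀ M .{{_ : NonZero M}} i w → hits M i (M + w) ≡ hits M i w + δ (M + w) i
hits-periodic M@(suc m) zero    w       = trans (hits₀-periodic M w) (sym (+-identityʳ _))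
hits-periodic M@(suc m) (suc i) zero    = hits-below M i (m + 0) (s≤s (≤-reflexive (+-identityʳ m)))
hits-periodic M@(suc m) (suc i) (suc w) = begin
    hits M i (m + suc w)                  ≡⟨ cong (hits M i) (+-suc m w) ⟩
    hits M i (M + w)                      ≡⟨ hits-periodic M i w ⟩
    hits M i w + δ (M + w) i              ≡⟨ cong (λ v → hits M i w + δ v i) (+-suc m w) ⟨
    hits M i w + δ (m + suc w) i          ∎

zeros : ℕ → List Bool → List ℕ
zeros k []          = []
zeros k (true  ∷ w) = zeros (suc k) w
zeros k (false ∷ w) = k ∷ zeros (suc k) w

zeros-ones : ∀ r k → zeros k (replicate r true) ≡ []
zeros-ones zero    k = refl
zeros-ones (suc r) k = zeros-ones r (suc k)

zeros-ones-++ : ∀ r k v → zeros k (replicate r true ++ v) ≡ zeros (r + k) v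
zeros-ones-++ zero    k v = refl
zeros-ones-++ (suc r) k v = trans (zeros-ones-++ r (suc k) v) (cong (λ i → zeros i v) (+-suc r k))

zeros-++ : ∀ k w v → zeros k (w ++ v) ≡ zeros k w ++ zeros (length w + k) v
zeros-++ k []          v = refl
zeros-++ k (true  ∷ w) v = trans (zeros-++ (suc k) w v) (cong (λ i → zeros (suc k) w ++ zeros i v) (+-suc (length w) k))
zeros-++ k (false ∷ w) v = cong (k ∷_) (trans (zeros-++ (suc k) w v) (cong (λ i → zeros (suc k) w ++ zeros i v) (+-suc (length w) k)))

zeros-shift : ∀ s k w → zeros (s + k) w ≡ map (s +_) (zeros k w)
zeros-shift s k []          = refl
zeros-shift s k (true  ∷ w) = trans (cong (λ i → zeros i w) (sym (+-suc s k))) (zeros-shift s (suc k) w)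
zeros-shift s k (false ∷ w) = cong ((s + k) ∷_) (trans (cong (λ i → zeros i w) (sym (+-suc s k))) (zeros-shift s (suc k) w))

zeros-lower : ∀ k w → All (k ≤_) (zeros k w)
zeros-lower k []          = []
zeros-lower k (true  ∷ w) = All.map (≤-trans (n≤1+n k)) (zeros-lower (suc k) w)
zeros-lower k (false ∷ w) = ≤-refl ∷ All.map (≤-trans (n≤1+n k)) (zeros-lower (suc k) w)

zeros-upper : ∀ k w → All (_< k + length w) (zeros k w)
zeros-upper k []          = []
zeros-upper k (true  ∷ w) = subst (λ i → All (_< i) (zeros (suc k) w)) (sym (+-suc k (length w))) (zeros-upper (suc k) w)
zeros-upper k (false ∷ w) = subst (λ i → All (_< i) (k ∷ zeros (suc k) w)) (sym (+-suc k (length w)))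
  (s≤s (m≤m+n k (length w)) ∷ zeros-upper (suc k) w)

letter-zeros : ∀ k w i → i < length w → letter w i + count (i + k) (zeros k w) ≡ 1
letter-zeros k (true  ∷ w) zero    _        = cong suc (count-absent _ (zeros-lower (suc k) w))
letter-zeros k (false ∷ w) zero    _        = cong₂ _+_ (δ-refl k) (count-absent _ (zeros-lower (suc k) w))
letter-zeros k (true  ∷ w) (suc i) (s≤s i<) = subst (λ c → letter w i + count c (zeros (suc k) w) ≡ 1) (+-suc i k) (letter-zeros (suc k) w i i<)
letter-zeros k (false ∷ w) (suc i) (s≤s i<) =
  trans (cong (λ d → letter w i + (d + count (suc i + k) (zeros (suc k) w))) (δ-≢ (<⇒≢ (s≤s (m≤n+m k i)))))
    (subst (λ c → letter w i + count c (zeros (suc k) w) ≡ 1) (+-suc i k) (letter-zeros (suc k) w i i<))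

letter-count : ∀ x j → j < length x → letter x j + count (suc j) (zeros 1 x) ≡ 1
letter-count x j j< = subst (λ c → letter x j + count c (zeros 1 x) ≡ 1) (+-comm j 1) (letter-zeros 1 x j j<)

letter-count-mirror : ∀ x j → j < length x → letter x (length x ∸ 1 ∸ j) + ∑[ z ∈ zeros 1 x ] δ (length x ∸ z) j ≡ 1
letter-count-mirror x j j<n = begin
    letter x i + ∑[ z ∈ zeros 1 x ] δ (n ∸ z) j
  ≡⟨ cong (letter x i +_) (∑-cong-All (zeros-upper 1 x) λ z<1+n → δ-∸-reflect (s≤s⁻¹ z<1+n) (<⇒≤ j<n)) ⟨
    letter x i + count (n ∸ j) (zeros 1 x)
  ≡⟨ cong (λ c → letter x i + count c (zeros 1 x)) n∸j≡i+1 ⟩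
    letter x i + count (i + 1) (zeros 1 x)
  ≡⟨ letter-zeros 1 x i i<n ⟩
    1
  ∎
  where
  n = length x
  i = n ∸ 1 ∸ j
  i≡n∸[1+j] : i ≡ n ∸ suc j
  i≡n∸[1+j] = ∸-+-assoc n 1 j
  i<n : i < n
  i<n = subst (_< n) (sym i≡n∸[1+j]) (∸-monoʳ-< (s≤s z≤n) j<n)
  n∸j≡i+1 : n ∸ j ≡ i + 1
  n∸j≡i+1 = trans (+-∸-assoc 1 j<n) (trans (+-comm 1 (n ∸ suc j)) (cong (_+ 1) (sym i≡n∸[1+j])))

data RotationShape (r k : ℕ) : List Bool → List Bool → Set where
  full  : ∀ u → RotationShape r k (replicate r true ++ u) (u ++ replicate (r + k) true)
  short : ∀ a u → RotationShape r k (replicate a true ++ false ∷ u) (u ++ false ∷ replicate (a + k) true)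

rotation-shape : ∀ r k w → r ≤ length w → RotationShape r k w (rotAux r k w)
rotation-shape zero    k w           _        = full w
rotation-shape (suc r) k (false ∷ w) _        = short 0 w
rotation-shape (suc r) k (true  ∷ w) (s≤s r≤) = prepend-one (rotation-shape r (suc k) w r≤)
  where
  prepend-one : ∀ {v y} → RotationShape r (suc k) v y → RotationShape (suc r) k (true ∷ v) y
  prepend-one (full u)    = subst (RotationShape (suc r) k _) (cong (λ i → u ++ replicate i true) (sym (+-suc r k))) (full u)
  prepend-one (short a u) = subst (RotationShape (suc r) k _) (cong (λ i → u ++ false ∷ replicate i true) (sym (+-suc a k))) (short (suc a) u)

length-rotAux : ∀ r k w → r ≤ length w → length (rotAux r k w) ≡ k + length w
length-rotAux zero    k w           _        = begin
  length (w ++ replicate k true)        ≡⟨ length-++ w ⟩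
  length w + length (replicate k true)  ≡⟨ cong (length w +_) (length-replicate k) ⟩
  length w + k                          ≡⟨ +-comm (length w) k ⟩
  k + length w                          ∎
length-rotAux (suc r) k (false ∷ w) _        = begin
  length (w ++ false ∷ replicate k true)      ≡⟨ length-++ w ⟩
  length w + suc (length (replicate k true))  ≡⟨ cong (λ i → length w + suc i) (length-replicate k) ⟩
  length w + suc k                            ≡⟨ +-comm (length w) (suc k) ⟩
  suc (k + length w)                          ≡⟨ +-suc k (length w) ⟨
  k + suc (length w)                          ∎
length-rotAux (suc r) k (true  ∷ w) (s≤s r≤) = trans (length-rotAux r (suc k) w r≤) (sym (+-suc k (length w)))

module Telescope {A : Set} (f : A → A) (P : A → Set) (f-preserves : ∀ {x} → P x → P (f x))
                 (V a b : A → ℕ) (step : ∀ {x} → P x → V (f x) + b x ≡ V x + a x) where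

  iter-preserves : ∀ k {x} → P x → P (iter f k x)
  iter-preserves zero    px = px
  iter-preserves (suc k) px = f-preserves (iter-preserves k px)

  telescope : ∀ k {x} → P x →
              V (iter f k x) + sumTo k (λ i → b (iter f i x)) ≡ V x + sumTo k (λ i → a (iter f i x))
  telescope zero    px = refl
  telescope (suc k) {x} px = begin
      V (f y) + (Sb + b y)  ≡⟨ x∙yz≈xz∙y (V (f y)) Sb (b y) ⟩
      V (f y) + b y + Sb    ≡⟨ cong (_+ Sb) (step (iter-preserves k px)) ⟩
      V y + a y + Sb        ≡⟨ xy∙z≈xz∙y (V y) (a y) Sb ⟩
      V y + Sb + a y        ≡⟨ cong (_+ a y) (telescope k px) ⟩
      V x + Sa + a y        ≡⟨ +-assoc (V x) Sa (a y) ⟩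
      V x + (Sa + a y)      ∎
    where
    y  = iter f k x
    Sa = sumTo k (λ i → a (iter f i x))
    Sb = sumTo k (λ i → b (iter f i x))

  periodic-sums : ∀ p {x} → P x → iter f p x ≡ x →
                  sumTo p (λ i → a (iter f i x)) ≡ sumTo p (λ i → b (iter f i x))
  periodic-sums p {x} px periodic =
    sym (+-cancelˡ-≡ (V x) _ _ (subst (λ y → V y + Sb ≡ V x + Sa) periodic (telescope p px)))
    where
    Sa = sumTo p (λ i → a (iter f i x))
    Sb = sumTo p (λ i → b (iter f i x))

module Potential (M : ℕ) .{{_ : NonZero M}} (j : ℕ) where

  θ₀ θ₁ : ℕ → ℕ
  θ₀ = hits M j
  θ₁ = hits M (j + M)

  θ₀-split : ∀ w → θ₀ w ≡ θ₁ w + δ w j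
  θ₀-split = hits-split M j

  θ₁-periodic : ∀ w → θ₁ (M + w) ≡ θ₁ w + δ w j
  θ₁-periodic w = trans (hits-periodic M (j + M) w) (cong (θ₁ w +_) (trans (cong (δ (M + w)) (+-comm j M)) (δ-+ˡ M w j)))

  -- For u < v this is θ₀ of the number of letters strictly between positions u and v; for u > v it
  -- is θ₁ of that number when the word 0x of length n + 1 is read cyclically from u to v.
  weight : ℕ → ℕ → ℕ → ℕ
  weight n zero    zero    = 0
  weight n zero    (suc v) = θ₀ v
  weight n (suc u) zero    = θ₁ (n ∸ suc u)
  weight n (suc u) (suc v) = weight n u v

  weight-diag : ∀ n u → weight n u u ≡ 0
  weight-diag n zero    = refl
  weight-diag n (suc u) = weight-diag n u

  weight-shift : ∀ n s u v → weight n (s + u) (s + v) ≡ weight n u v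
  weight-shift n zero    u v = refl
  weight-shift n (suc s) u v = weight-shift n s u v

  weight-below : ∀ n u k → weight n u (suc (u + k)) ≡ θ₀ k
  weight-below n zero    k = refl
  weight-below n (suc u) k = weight-below n u k

  weight-above : ∀ n v k → weight n (suc (v + k)) v ≡ θ₁ (n ∸ suc k)
  weight-above n zero    k = refl
  weight-above n (suc v) k = weight-above n v k

  Φ : ℕ → List ℕ → ℕ
  Φ n zs = ∑[ u ∈ zs ] ∑[ v ∈ zs ] weight n u v

  cross : ℕ → ℕ → List ℕ → ℕ
  cross n c zs = ∑[ z ∈ zs ] (weight n c z + weight n z c)

  Φ-∷ : ∀ n c zs → Φ n (c ∷ zs) ≡ cross n c zs + Φ n zs
  Φ-∷ n c zs = begin
      weight n c c + ∑ zs (weight n c) + ∑[ u ∈ zs ] (weight n u c + ∑ zs (weight n u))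
    ≡⟨ cong₂ _+_ (cong (_+ ∑ zs (weight n c)) (weight-diag n c)) (∑-+ (λ u → weight n u c) _ zs) ⟩
      ∑ zs (weight n c) + (∑[ u ∈ zs ] weight n u c + Φ n zs)
    ≡⟨ +-assoc (∑ zs (weight n c)) (∑[ u ∈ zs ] weight n u c) (Φ n zs) ⟨
      ∑ zs (weight n c) + ∑[ u ∈ zs ] weight n u c + Φ n zs
    ≡⟨ cong (_+ Φ n zs) (∑-+ (weight n c) (λ u → weight n u c) zs) ⟨
      cross n c zs + Φ n zs
    ∎

  Φ-map : ∀ n (σ : ℕ → ℕ) → (∀ u v → weight n (σ u) (σ v) ≡ weight n u v) → ∀ zs → Φ n (map σ zs) ≡ Φ n zs
  Φ-map n σ σ-weight zs =
    trans (∑-map _ σ zs) (∑-cong zs λ u → trans (∑-map _ σ zs) (∑-cong zs (σ-weight u)))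

  Φ-↭ : ∀ n {xs ys} → xs ↭ ys → Φ n xs ≡ Φ n ys
  Φ-↭ n {xs} xs↭ys = trans (∑-cong xs λ u → ∑-↭ (weight n u) xs↭ys) (∑-↭ _ xs↭ys)

  countMirrored : ℕ → List ℕ → ℕ
  countMirrored n zs = ∑[ z ∈ zs ] δ (n ∸ z) j

  Φ-exchange : ∀ {P : ℕ → Set} n c c′ (τ σ : ℕ → ℕ) zs →
               (∀ u v → weight n (τ u) (τ v) ≡ weight n u v) →
               (∀ u v → weight n (σ u) (σ v) ≡ weight n u v) →
               All P zs →
               (∀ {z} → P z → weight n c (τ z) + weight n (τ z) c + δ (σ z) (suc j)
                              ≡ weight n c′ (σ z) + weight n (σ z) c′ + δ (n ∸ σ z) j) →
               Φ n (c ∷ map τ zs) + count (suc j) (map σ zs) ≡ Φ n (c′ ∷ map σ zs) + countMirrored n (map σ zs)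
  Φ-exchange n c c′ τ σ zs τ-weight σ-weight ps pointwise = begin
      Φ n (c ∷ map τ zs) + count (suc j) (map σ zs)
    ≡⟨ cong₂ _+_ (Φ-∷ n c (map τ zs)) (∑-map _ σ zs) ⟩
      cross n c (map τ zs) + Φ n (map τ zs) + ∑[ z ∈ zs ] δ (σ z) (suc j)
    ≡⟨ cong₂ (λ x y → x + y + ∑[ z ∈ zs ] δ (σ z) (suc j)) (∑-map _ τ zs) (Φ-map n τ τ-weight zs) ⟩
      crossτ + Φ n zs + ∑[ z ∈ zs ] δ (σ z) (suc j)
    ≡⟨ xy∙z≈xz∙y crossτ (Φ n zs) _ ⟩
      crossτ + ∑[ z ∈ zs ] δ (σ z) (suc j) + Φ n zs
    ≡⟨ cong (_+ Φ n zs) (∑-exchange ps pointwise) ⟩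
      crossσ + ∑[ z ∈ zs ] δ (n ∸ σ z) j + Φ n zs
    ≡⟨ xy∙z≈xz∙y crossσ _ (Φ n zs) ⟩
      crossσ + Φ n zs + ∑[ z ∈ zs ] δ (n ∸ σ z) j
    ≡⟨ cong₂ (λ x y → x + y + ∑[ z ∈ zs ] δ (n ∸ σ z) j) (∑-map _ σ zs) (Φ-map n σ σ-weight zs) ⟨
      cross n c′ (map σ zs) + Φ n (map σ zs) + ∑[ z ∈ zs ] δ (n ∸ σ z) j
    ≡⟨ cong₂ _+_ (Φ-∷ n c′ (map σ zs)) (∑-map _ σ zs) ⟨
      Φ n (c′ ∷ map σ zs) + countMirrored n (map σ zs)
    ∎
    where
    crossτ = ∑[ z ∈ zs ] (weight n c (τ z) + weight n (τ z) c)
    crossσ = ∑[ z ∈ zs ] (weight n c′ (σ z) + weight n (σ z) c′)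

  weight-exchange-full : ∀ {n} L s → n ≡ M + L → s < L →
                         weight n 0 (suc s) + weight n (suc s) 0 + δ (suc M + s) (suc j)
                         ≡ weight n 0 (suc M + s) + weight n (suc M + s) 0 + δ (n ∸ (suc M + s)) j
  weight-exchange-full L s refl s<L = begin
      θ₀ s + θ₁ ((M + L) ∸ suc s) + δ (M + s) j
    ≡⟨ cong (λ i → θ₀ s + θ₁ i + δ (M + s) j) (+-∸-assoc M s<L) ⟩
      θ₀ s + θ₁ (M + k) + δ (M + s) j
    ≡⟨ cong (λ t → θ₀ s + t + δ (M + s) j) (θ₁-periodic k) ⟩
      θ₀ s + (θ₁ k + δ k j) + δ (M + s) j
    ≡⟨ rearrange (θ₀ s) (θ₁ k) (δ k j) (δ (M + s) j) ⟩
      θ₀ s + δ (M + s) j + θ₁ k + δ k j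
    ≡⟨ cong (λ t → t + θ₁ k + δ k j) (hits-periodic M j s) ⟨
      θ₀ (M + s) + θ₁ k + δ k j
    ≡⟨ cong (λ i → θ₀ (M + s) + θ₁ i + δ i j) M+L∸[1+M+s]≡k ⟨
      θ₀ (M + s) + θ₁ ((M + L) ∸ suc (M + s)) + δ ((M + L) ∸ suc (M + s)) j
    ∎
    where
    k = L ∸ suc s
    M+L∸[1+M+s]≡k : (M + L) ∸ suc (M + s) ≡ k
    M+L∸[1+M+s]≡k = trans (cong ((M + L) ∸_) (sym (+-suc M s))) ([m+n]∸[m+o]≡n∸o M L (suc s))
    rearrange : ∀ a b c d → a + (b + c) + d ≡ a + d + b + c
    rearrange = solve-∀

  weight-exchange-short : ∀ {n} a L s → n ≡ a + suc L → s ≤ L →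
                          weight n (suc L) s + weight n s (suc L) + δ (suc a + s) (suc j)
                          ≡ weight n 0 (suc a + s) + weight n (suc a + s) 0 + δ (n ∸ (suc a + s)) j
  weight-exchange-short a L s refl s≤L with L ∸ s | m+[n∸m]≡n s≤L
  ... | k | refl = begin
      weight n (suc (s + k)) s + weight n s (suc (s + k)) + δ (a + s) j
    ≡⟨ cong₂ (λ x y → x + y + δ (a + s) j) (trans (weight-above n s k) (cong θ₁ n∸[1+k]≡a+s)) (weight-below n s k) ⟩
      θ₁ (a + s) + θ₀ k + δ (a + s) j
    ≡⟨ xy∙z≈xz∙y (θ₁ (a + s)) (θ₀ k) (δ (a + s) j) ⟩
      θ₁ (a + s) + δ (a + s) j + θ₀ k
    ≡⟨ cong₂ _+_ (sym (θ₀-split (a + s))) (θ₀-split k) ⟩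
      θ₀ (a + s) + (θ₁ k + δ k j)
    ≡⟨ +-assoc (θ₀ (a + s)) (θ₁ k) (δ k j) ⟨
      θ₀ (a + s) + θ₁ k + δ k j
    ≡⟨ cong (λ i → θ₀ (a + s) + θ₁ i + δ i j) n∸[1+a+s]≡k ⟨
      θ₀ (a + s) + θ₁ (n ∸ suc (a + s)) + δ (n ∸ suc (a + s)) j
    ∎
    where
    n = a + suc (s + k)
    n≡[a+s]+[1+k] : n ≡ (a + s) + suc k
    n≡[a+s]+[1+k] = reassociate a s k
      where
      reassociate : ∀ a s k → a + suc (s + k) ≡ (a + s) + suc k
      reassociate = solve-∀
    n∸[1+a+s]≡k : n ∸ suc (a + s) ≡ k
    n∸[1+a+s]≡k = trans (cong (_∸ suc (a + s)) (trans n≡[a+s]+[1+k] (+-suc (a + s) k))) (m+n∸m≡n (suc (a + s)) k)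
    n∸[1+k]≡a+s : n ∸ suc k ≡ a + s
    n∸[1+k]≡a+s = trans (cong (_∸ suc k) n≡[a+s]+[1+k]) (m+n∸n≡m (a + s) (suc k))

  potential : ℕ → List Bool → ℕ
  potential n x = Φ n (zeros 0 (false ∷ x))

  -- Positions in zeros 1 x are shifted by one, so the two counts are 1 − x_j and 1 − x_{n−1−j}.
  PotentialExchange : List Bool → List Bool → Set
  PotentialExchange x y = potential (length x) y + count (suc j) (zeros 1 x)
                          ≡ potential (length x) x + countMirrored (length x) (zeros 1 x)

  potential-exchange-full : ∀ u → PotentialExchange (replicate M true ++ u) (u ++ replicate (M + 0) true)
  potential-exchange-full u = begin
      Φ n (0 ∷ zeros 1 (u ++ ones)) + count (suc j) (zeros 1 x)
    ≡⟨ cong₂ (λ zs zs′ → Φ n (0 ∷ zs) + count (suc j) zs′) zeros-y zeros-x ⟩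
      Φ n (0 ∷ map suc S) + count (suc j) (map (suc M +_) S)
    ≡⟨ Φ-exchange n 0 0 suc (suc M +_) S (λ _ _ → refl) (weight-shift n (suc M)) (zeros-upper 0 u)
                  (weight-exchange-full L _ n≡M+L) ⟩
      Φ n (0 ∷ map (suc M +_) S) + countMirrored n (map (suc M +_) S)
    ≡⟨ cong (λ zs → Φ n (0 ∷ zs) + countMirrored n zs) zeros-x ⟨
      potential n x + countMirrored n (zeros 1 x)
    ∎
    where
    x    = replicate M true ++ u
    ones = replicate (M + 0) true
    n    = length x
    L    = length u
    S    = zeros 0 u
    n≡M+L : n ≡ M + L
    n≡M+L = trans (length-++ (replicate M true)) (cong (_+ L) (length-replicate M))
    zeros-x : zeros 1 x ≡ map (suc M +_) S
    zeros-x = trans (zeros-ones-++ M 1 u) (trans (cong (λ i → zeros i u) (+-suc M 0)) (zeros-shift (suc M) 0 u))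
    zeros-y : zeros 1 (u ++ ones) ≡ map suc S
    zeros-y = begin
      zeros 1 (u ++ ones)               ≡⟨ zeros-++ 1 u ones ⟩
      zeros 1 u ++ zeros (L + 1) ones   ≡⟨ cong (zeros 1 u ++_) (zeros-ones (M + 0) (L + 1)) ⟩
      zeros 1 u ++ []                   ≡⟨ ++-identityʳ (zeros 1 u) ⟩
      zeros 1 u                         ≡⟨ zeros-shift 1 0 u ⟩
      map suc S                         ∎

  potential-exchange-short : ∀ a u → PotentialExchange (replicate a true ++ false ∷ u) (u ++ false ∷ replicate (a + 0) true)
  potential-exchange-short a u = begin
      Φ n (zeros 0 (false ∷ u ++ false ∷ ones)) + count (suc j) (zeros 1 x)
    ≡⟨ cong₂ _+_ (trans (cong (Φ n) zeros-y) (Φ-↭ n (↭-sym (∷↭∷ʳ (suc L) S)))) (cong (count (suc j)) zeros-x) ⟩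
      Φ n (suc L ∷ S) + count (suc j) (map (suc a +_) S)
    ≡⟨ cong (λ zs → Φ n (suc L ∷ zs) + count (suc j) (map (suc a +_) S)) (map-id S) ⟨
      Φ n (suc L ∷ map id S) + count (suc j) (map (suc a +_) S)
    ≡⟨ Φ-exchange n (suc L) 0 id (suc a +_) S (λ _ _ → refl) (weight-shift n (suc a)) (zeros-upper 0 (false ∷ u))
                  (λ s<1+L → weight-exchange-short a L _ n≡a+[1+L] (s≤s⁻¹ s<1+L)) ⟩
      Φ n (0 ∷ map (suc a +_) S) + countMirrored n (map (suc a +_) S)
    ≡⟨ cong (λ zs → Φ n (0 ∷ zs) + countMirrored n zs) zeros-x ⟨
      potential n x + countMirrored n (zeros 1 x)
    ∎
    where
    x    = replicate a true ++ false ∷ u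
    ones = replicate (a + 0) true
    n    = length x
    L    = length u
    S    = zeros 0 (false ∷ u)
    n≡a+[1+L] : n ≡ a + suc L
    n≡a+[1+L] = trans (length-++ (replicate a true)) (cong (_+ suc L) (length-replicate a))
    zeros-x : zeros 1 x ≡ map (suc a +_) S
    zeros-x = trans (zeros-ones-++ a 1 (false ∷ u))
                    (trans (cong (λ i → zeros i (false ∷ u)) (+-suc a 0)) (zeros-shift (suc a) 0 (false ∷ u)))
    zeros-y : zeros 0 (false ∷ u ++ false ∷ ones) ≡ S ∷ʳ suc L
    zeros-y = trans (zeros-++ 0 (false ∷ u) (false ∷ ones))
                    (cong (S ++_) (cong₂ _∷_ (+-identityʳ (suc L)) (zeros-ones (a + 0) _)))

  potential-exchange : ∀ x → M ≤ length x → PotentialExchange x (ρ M x)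
  potential-exchange x M≤ with ρ M x | rotation-shape M 0 x M≤
  ... | _ | full u    = potential-exchange-full u
  ... | _ | short a u = potential-exchange-short a u

  potential-step : ∀ {n} x → length x ≡ n → M ≤ n → j < n →
                   potential n (ρ M x) + letter x (n ∸ 1 ∸ j) ≡ potential n x + letter x j
  potential-step x refl M≤n j<n =
    swap-complements {potential (length x) (ρ M x)} {potential (length x) x}
      (potential-exchange x M≤n) (trans (letter-count x j j<n) (sym (letter-count-mirror x j j<n)))

corollary1 : (m n : ℕ) → 1 ≤ m → m ≤ n → (w : List Bool) → length w ≡ n →
             (p : ℕ) → 1 ≤ p → iter (ρ m) p w ≡ w →
             ((q : ℕ) → 1 ≤ q → q < p → iter (ρ m) q w ≢ w) →
             (j : ℕ) → j < n →
             sumTo p (λ k → letter (iter (ρ m) k w) j)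
               ≡ sumTo p (λ k → letter (iter (ρ m) k w) (n ∸ 1 ∸ j))
corollary1 m@(suc _) n _ m≤n w len-w p _ periodic _ j j<n = periodic-sums p len-w periodic
  where
  open Potential m j using (potential; potential-step)
  length-preserved : ∀ {x} → length x ≡ n → length (ρ m x) ≡ n
  length-preserved {x} refl = length-rotAux m 0 x m≤n
  open Telescope (ρ m) (λ x → length x ≡ n) (λ {x} → length-preserved {x})
                 (potential n) (λ x → letter x j) (λ x → letter x (n ∸ 1 ∸ j))
                 (λ {x} len-x → potential-step x len-x m≤n j<n)
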